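{- Let $L$ be a Latin square and let $D\subseteq L$, and let $k\geq 1$ be an integer. Then $D$ is a $k$-strong defining set of $L$ if and only if for every $D'\subset D$ with $|D'|<k$, the set $D\setminus D'$ is a defining set of $L$. Moreover, a $k$-strong defining set $D$ of $L$ is minimally $k$-strong if and only if for each triple $(i,j;L_{i,j})\in D$ there exists a Latin trade $T\subseteq L$ such that $(i,j;L_{i,j})\in T$ and $|T\cap D|=k$.
   Context: A partial Latin square (PLS) of order $n$ is an $n\times n$ array, with rows, columns and symbols each indexed by an $n$-set, in which some cells may be empty and each symbol occurs at most once in each row and column; a Latin square is a PLS with no empty cells. An array is identified with its set of triples $(i,j;L_{i,j})$ (row, column; symbol), so subsets make sense. A Latin trade is a non-empty PLS $T$ for which there is a PLS $T'$ of the same order (a disjoint mate) such that $T\cap T'=\emptyset$, $T$ and $T'$ have the same set of non-empty cells, each row of $T$ contains the same set of symbols as the corresponding row of $T'$, and each column of $T$ contains the same set of symbols as the corresponding column of $T'$. A defining set of a Latin square $L$ is a subset $D\subseteq L$ such that no Latin square of the same order other than $L$ contains $D$. A defining set $D$ of $L$ is $k$-strong if $|D\cap T|\geq k$ for every Latin trade $T\subseteq L$; it is minimally $k$-strong if it is $k$-strong but no proper subset of $D$ is $k$-strong. -}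

module Defs where

open import Data.Nat using (ℕ; zero; suc; _+_; _≥_; _<_)
open import Data.Fin using (Fin)
open import Data.Bool using (Bool; true; false; _∧_; not)
open import Data.Product using (_×_; _,_; Σ; ∃; ∃-syntax)
open import Data.Empty using (⊥)
open import Relation.Nullary using (¬_)
open import Relation.Binary.PropositionalEquality using (_≡_)
open import Function.Bundles using (_⇔_)

-- A triple (row, column; symbol) of an array of order n.
Triple : ℕ → Set
Triple n = Fin n × Fin n × Fin n

TSet : ℕ → Set
TSet n = Triple n → Bool

_∈_ : {n : ℕ} → Triple n → TSet n → Set
t ∈ S = S t ≡ true

_∉_ : {n : ℕ} → Triple n → TSet n → Set
t ∉ S = ¬ (t ∈ S)

_⊆_ : {n : ℕ} → TSet n → TSet n → Set
A ⊆ B = ∀ t → t ∈ A → t ∈ B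

_≐_ : {n : ℕ} → TSet n → TSet n → Set
A ≐ B = ∀ t → A t ≡ B t

_∩_ : {n : ℕ} → TSet n → TSet n → TSet n
(A ∩ B) t = A t ∧ B t

_∖_ : {n : ℕ} → TSet n → TSet n → TSet n
(A ∖ B) t = A t ∧ not (B t)

sumFin : (n : ℕ) → (Fin n → ℕ) → ℕ
sumFin zero f = 0
sumFin (suc n) f = f Fin.zero + sumFin n (λ i → f (Fin.suc i))

b2n : Bool → ℕ
b2n true = 1
b2n false = 0

∣_∣ : {n : ℕ} → TSet n → ℕ
∣_∣ {n} S = sumFin n λ i → sumFin n λ j → sumFin n λ s → b2n (S (i , j , s))

record IsPLS {n : ℕ} (P : TSet n) : Set where
  field
    cell : ∀ i j s s' → (i , j , s) ∈ P → (i , j , s') ∈ P → s ≡ s'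
    row  : ∀ i j j' s → (i , j , s) ∈ P → (i , j' , s) ∈ P → j ≡ j'
    col  : ∀ i i' j s → (i , j , s) ∈ P → (i' , j , s) ∈ P → i ≡ i'

record IsLatinSquare {n : ℕ} (L : TSet n) : Set where
  field
    pls  : IsPLS L
    full : ∀ i j → ∃[ s ] ((i , j , s) ∈ L)

record IsLatinTrade {n : ℕ} (T : TSet n) : Set where
  field
    nonempty : ∃[ t ] (t ∈ T)
    pls      : IsPLS T
    mate     : Σ (TSet n) λ T' →
                 IsPLS T'
               × (∀ t → t ∈ T → t ∉ T')
               × (∀ i j → (∃[ s ] ((i , j , s) ∈ T)) ⇔ (∃[ s ] ((i , j , s) ∈ T')))
               × (∀ i s → (∃[ j ] ((i , j , s) ∈ T)) ⇔ (∃[ j ] ((i , j , s) ∈ T')))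
               × (∀ j s → (∃[ i ] ((i , j , s) ∈ T)) ⇔ (∃[ i ] ((i , j , s) ∈ T')))

IsDefiningSet : {n : ℕ} → TSet n → TSet n → Set
IsDefiningSet {n} L D =
  D ⊆ L × (∀ (L' : TSet n) → IsLatinSquare L' → D ⊆ L' → L' ≐ L)

IsKStrong : {n : ℕ} → ℕ → TSet n → TSet n → Set
IsKStrong {n} k L D =
  IsDefiningSet L D × (∀ (T : TSet n) → IsLatinTrade T → T ⊆ L → ∣ D ∩ T ∣ ≥ k)

_⊂_ : {n : ℕ} → TSet n → TSet n → Set
A ⊂ B = A ⊆ B × ∃[ t ] (t ∈ B × t ∉ A)

IsMinimallyKStrong : {n : ℕ} → ℕ → TSet n → TSet n → Set
IsMinimallyKStrong {n} k L D =
  IsKStrong k L D × (∀ (D'' : TSet n) → D'' ⊂ D → ¬ IsKStrong k L D'')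

{-# OPTIONS --safe #-}
-- The trades inside a Latin square L are exactly the differences L ∖ L' with L' another
-- Latin square: L ∖ L' is a trade with mate L' ∖ L, and swapping a trade T ⊆ L for a
-- disjoint mate gives a Latin square L' with L ∖ L' = T. Consequently E ⊆ L is a defining
-- set iff it meets every trade in L, and both halves of the first equivalence follow by
-- counting D ∩ T. For minimality, a trade T ∋ t with |T ∩ D| = k forbids dropping t from D;
-- conversely, if no such trade exists, every trade still meets D ∖ {t} in k triples, so
-- D ∖ {t} is k-strong. Whether such a trade exists is decided by exhaustive search over
-- all sets of triples, which is what makes the argument constructive.
module Submission where

open import Defs
open import Data.Nat using (ℕ; zero; suc; _+_; _*_; _≤_; _<_; _≥_; z≤n; s≤s; s≤s⁻¹)
import Data.Nat.Properties as ℕ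
open import Data.Nat.Properties
  using (≤-refl; ≤-trans; ≤-antisym; ≤-reflexive; +-mono-≤; +-mono-<-≤; +-mono-≤-<; +-suc; <⇒≱; ≮⇒≥; ≤∧≢⇒<)
open import Data.Fin using (Fin; zero; suc; punchOut; combine; remQuot)
import Data.Fin.Properties as Fin
open import Data.Fin.Properties using (all?; any?; suc-injective; punchOut-injective; <⇒notInjective; remQuot-combine)
open import Data.Fin.Subset using (Subset)
open import Data.Fin.Subset.Properties using (anySubset?)
open import Data.Vec using (lookup; tabulate)
open import Data.Vec.Properties using (lookup∘tabulate)
open import Data.Bool using (true; false; _∧_; _∨_; not)
import Data.Bool.Properties as Bool
open import Data.Product using (_×_; _,_; proj₁; proj₂; ∃; ∃-syntax; map₂)
open import Data.Product.Properties using (≡-dec)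
open import Data.Sum using (_⊎_; inj₁; inj₂; [_,_]′)
open import Data.Empty using (⊥; ⊥-elim)
open import Function using (_∘_)
open import Function.Bundles using (_⇔_; mk⇔; Equivalence)
open import Function.Definitions using (Injective)
open import Relation.Nullary using (¬_; Dec; yes; no; does; contradiction)
open import Relation.Nullary.Decidable using (map′; _×-dec_; _→-dec_; dec-true; dec-false)
open import Relation.Binary.Definitions using (DecidableEquality)
open import Relation.Binary.PropositionalEquality using (_≡_; _≢_; refl; sym; trans; cong; cong₂; subst)

private variable
  n k : ℕ
  t u : Triple n
  A B D E L P T : TSet n

_∪_ : TSet n → TSet n → TSet n
(A ∪ B) t = A t ∨ B t

_≟_ : DecidableEquality (Triple n)
_≟_ = ≡-dec Fin._≟_ (≡-dec Fin._≟_ Fin._≟_)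

｛_｝ : Triple n → TSet n
｛ t ｝ u = does (u ≟ t)

Disjoint : TSet n → TSet n → Set
Disjoint A B = ∀ t → t ∈ A → t ∉ B

infix 4 _∈?_

_∈?_ : (t : Triple n) (S : TSet n) → Dec (t ∈ S)
t ∈? S = S t Bool.≟ true

-- The sets are explicit: Agda cannot infer them through the Boolean connectives.
∈-∩⁺ : ∀ A B → t ∈ A → t ∈ B → t ∈ (A ∩ B)
∈-∩⁺ _ _ p q = cong₂ _∧_ p q

∈-∩⁻ˡ : ∀ A B → t ∈ (A ∩ B) → t ∈ A
∈-∩⁻ˡ {t = t} A _ p with A t
... | true  = refl
... | false = p

∈-∩⁻ʳ : ∀ A B → t ∈ (A ∩ B) → t ∈ B
∈-∩⁻ʳ {t = t} A _ p with A t
... | true  = p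
... | false = contradiction p λ ()

∈-∖⁺ : ∀ A B → t ∈ A → t ∉ B → t ∈ (A ∖ B)
∈-∖⁺ _ _ p q rewrite p | Bool.¬-not q = refl

∈-∖⁻ˡ : ∀ A B → t ∈ (A ∖ B) → t ∈ A
∈-∖⁻ˡ A B = ∈-∩⁻ˡ A (not ∘ B)

∈-∖⁻ʳ : ∀ A B → t ∈ (A ∖ B) → t ∉ B
∈-∖⁻ʳ A B p q = contradiction (trans (sym (cong not q)) (∈-∩⁻ʳ A (not ∘ B) p)) λ ()

∈-∪⁺ˡ : ∀ A B → t ∈ A → t ∈ (A ∪ B)
∈-∪⁺ˡ _ _ p rewrite p = refl

∈-∪⁺ʳ : ∀ A B → t ∈ B → t ∈ (A ∪ B)
∈-∪⁺ʳ {t = t} A _ p with A t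
... | true  = refl
... | false = p

∈-∪⁻ : ∀ A B → t ∈ (A ∪ B) → t ∈ A ⊎ t ∈ B
∈-∪⁻ {t = t} A _ p with A t
... | true  = inj₁ refl
... | false = inj₂ p

∉∖⇒∈ : ∀ A B → t ∈ A → t ∉ (A ∖ B) → t ∈ B
∉∖⇒∈ {t = t} A B p q with t ∈? B
... | yes r = r
... | no  r = contradiction (∈-∖⁺ A B p r) q

∈｛｝ : t ∈ ｛ t ｝
∈｛｝ {t = t} = dec-true (t ≟ t) refl

≢⇒∉｛｝ : u ≢ t → u ∉ ｛ t ｝
≢⇒∉｛｝ {u = u} {t = t} u≢t p = contradiction (trans (sym p) (dec-false (u ≟ t) u≢t)) λ ()

∖⊆ : (A ∖ B) ⊆ A
∖⊆ {A = A} {B = B} _ = ∈-∖⁻ˡ A B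

≐⇒⊆ : A ≐ B → A ⊆ B
≐⇒⊆ A≐B t p = trans (sym (A≐B t)) p

≐⇒⊇ : A ≐ B → B ⊆ A
≐⇒⊇ A≐B t p = trans (A≐B t) p

⊆-antisym : A ⊆ B → B ⊆ A → A ≐ B
⊆-antisym {A = A} {B = B} A⊆B B⊆A t with A t in a | B t in b
... | true  | true  = refl
... | false | false = refl
... | true  | false = contradiction (trans (sym (A⊆B t a)) b) λ ()
... | false | true  = contradiction (trans (sym (B⊆A t b)) a) λ ()

sumFin-mono-≤ : ∀ n {f g : Fin n → ℕ} → (∀ i → f i ≤ g i) → sumFin n f ≤ sumFin n g
sumFin-mono-≤ zero    _   = z≤n
sumFin-mono-≤ (suc n) f≤g = +-mono-≤ (f≤g zero) (sumFin-mono-≤ n (f≤g ∘ suc))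

sumFin-mono-< : ∀ n {f g : Fin n → ℕ} → (∀ i → f i ≤ g i) → ∀ i → f i < g i → sumFin n f < sumFin n g
sumFin-mono-< (suc n) f≤g zero    fi<gi = +-mono-<-≤ fi<gi (sumFin-mono-≤ n (f≤g ∘ suc))
sumFin-mono-< (suc n) f≤g (suc i) fi<gi = +-mono-≤-< (f≤g zero) (sumFin-mono-< n (f≤g ∘ suc) i fi<gi)

sumFin-≤-suc : ∀ n {f g : Fin n → ℕ} i → (∀ j → j ≢ i → f j ≤ g j) → f i ≤ suc (g i) →
               sumFin n f ≤ suc (sumFin n g)
sumFin-≤-suc (suc n) zero    f≤g fi≤ = +-mono-≤ fi≤ (sumFin-mono-≤ n λ j → f≤g (suc j) λ ())
sumFin-≤-suc (suc n) {g = g} (suc i) f≤g fi≤ = ≤-trans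
  (+-mono-≤ (f≤g zero λ ()) (sumFin-≤-suc n i (λ j j≢i → f≤g (suc j) (j≢i ∘ suc-injective)) fi≤))
  (≤-reflexive (+-suc (g zero) _))

sumFin-zero : ∀ n {f : Fin n → ℕ} → (∀ i → f i ≡ 0) → sumFin n f ≡ 0
sumFin-zero zero    _   = refl
sumFin-zero (suc n) f≡0 = cong₂ _+_ (f≡0 zero) (sumFin-zero n (f≡0 ∘ suc))

b2n-mono : ∀ {x y} → (x ≡ true → y ≡ true) → b2n x ≤ b2n y
b2n-mono {false} _   = z≤n
b2n-mono {true}  x⇒y rewrite x⇒y refl = ≤-refl

⊆⇒∣∣≤ : A ⊆ B → ∣ A ∣ ≤ ∣ B ∣
⊆⇒∣∣≤ {n} A⊆B =
  sumFin-mono-≤ n λ i → sumFin-mono-≤ n λ j → sumFin-mono-≤ n λ s → b2n-mono (A⊆B (i , j , s))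

⊂⇒∣∣< : A ⊆ B → t ∈ B → t ∉ A → ∣ A ∣ < ∣ B ∣
⊂⇒∣∣< {n} {A} {B} {i , j , s} A⊆B t∈B t∉A =
  sumFin-mono-< n (λ i' → sumFin-mono-≤ n λ j' → sumFin-mono-≤ n λ s' → ≤ᵇ (i' , j' , s')) i
    (sumFin-mono-< n (λ j' → sumFin-mono-≤ n λ s' → ≤ᵇ (i , j' , s')) j
      (sumFin-mono-< n (λ s' → ≤ᵇ (i , j , s')) s <ᵇ))
  where
  ≤ᵇ : ∀ u → b2n (A u) ≤ b2n (B u)
  ≤ᵇ u = b2n-mono (A⊆B u)
  <ᵇ : b2n (A (i , j , s)) < b2n (B (i , j , s))
  <ᵇ rewrite t∈B | Bool.¬-not t∉A = ≤-refl

⊆-except⇒∣∣≤suc : (t : Triple n) → (∀ u → u ∈ A → u ≢ t → u ∈ B) → ∣ A ∣ ≤ suc ∣ B ∣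
⊆-except⇒∣∣≤suc {n} {A} {B} (i , j , s) A⊆B =
  sumFin-≤-suc n i (λ i' i'≢i → sumFin-mono-≤ n λ j' → sumFin-mono-≤ n λ s' → ≤ᵇ (i'≢i ∘ cong proj₁))
    (sumFin-≤-suc n j (λ j' j'≢j → sumFin-mono-≤ n λ s' → ≤ᵇ (j'≢j ∘ cong (proj₁ ∘ proj₂)))
      (sumFin-≤-suc n s (λ s' s'≢s → ≤ᵇ (s'≢s ∘ cong (proj₂ ∘ proj₂)))
        (≤-trans (b2n≤1 (A (i , j , s))) (s≤s z≤n))))
  where
  ≤ᵇ : ∀ {u} → u ≢ (i , j , s) → b2n (A u) ≤ b2n (B u)
  ≤ᵇ {u} u≢t = b2n-mono λ u∈A → A⊆B u u∈A u≢t
  b2n≤1 : ∀ x → b2n x ≤ 1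
  b2n≤1 true  = ≤-refl
  b2n≤1 false = z≤n

empty⇒∣∣≡0 : (∀ t → t ∉ A) → ∣ A ∣ ≡ 0
empty⇒∣∣≡0 {n} A-empty =
  sumFin-zero n λ i → sumFin-zero n λ j → sumFin-zero n λ s → cong b2n (Bool.¬-not (A-empty (i , j , s)))

≐⇒∣∣≡ : A ≐ B → ∣ A ∣ ≡ ∣ B ∣
≐⇒∣∣≡ A≐B = ≤-antisym (⊆⇒∣∣≤ (≐⇒⊆ A≐B)) (⊆⇒∣∣≤ (≐⇒⊇ A≐B))

∣∩∣-comm : (A B : TSet n) → ∣ A ∩ B ∣ ≡ ∣ B ∩ A ∣
∣∩∣-comm A B = ≐⇒∣∣≡ λ u → Bool.∧-comm (A u) (B u)

-- Lines of a partial Latin square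

injective⇒surjective : {f : Fin n → Fin n} → Injective _≡_ _≡_ f → ∀ y → ∃[ x ] f x ≡ y
injective⇒surjective {suc n} {f} f-inj y with any? (λ x → f x Fin.≟ y)
... | yes hit  = hit
... | no  miss = ⊥-elim (<⇒notInjective ≤-refl g-inj)
  where
  g : Fin (suc n) → Fin n
  g x = punchOut {i = y} {j = f x} (miss ∘ (x ,_) ∘ sym)
  g-inj : Injective _≡_ _≡_ g
  g-inj gx≡gx' = f-inj (punchOut-injective {i = y} _ _ gx≡gx')

total∧injective⇒surjective : {R : Fin n → Fin n → Set} → (∀ x → ∃[ y ] R x y) →
                             (∀ {x x' y} → R x y → R x' y → x ≡ x') → ∀ y → ∃[ x ] R x y
total∧injective⇒surjective {n} {R} total inj y =
  map₂ (λ {x} fx≡y → subst (R x) fx≡y (proj₂ (total x))) (injective⇒surjective {f = f} f-inj y)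
  where
  f : Fin n → Fin n
  f x = proj₁ (total x)
  f-inj : Injective _≡_ _≡_ f
  f-inj {x} {x'} fx≡fx' = inj (proj₂ (total x)) (subst (R x') (sym fx≡fx') (proj₂ (total x')))

-- line d a b x is the triple on line (a , b) of kind d whose free coordinate is x.
data Axis : Set where
  cell row col : Axis

line : Axis → Fin n → Fin n → Fin n → Triple n
line cell i j s = i , j , s
line row  i s j = i , j , s
line col  j s i = i , j , s

AtMostOnce : Axis → TSet n → Set
AtMostOnce d P = ∀ a b x y → line d a b x ∈ P → line d a b y ∈ P → x ≡ y

Covers : Axis → TSet n → Set
Covers d P = ∀ a b → ∃[ x ] (line d a b x ∈ P)

SameLines : Axis → TSet n → TSet n → Set
SameLines d P Q = ∀ a b → (∃[ x ] (line d a b x ∈ P)) ⇔ (∃[ x ] (line d a b x ∈ Q))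

isPLS⇒atMostOnce : IsPLS P → ∀ d → AtMostOnce d P
isPLS⇒atMostOnce pls cell i j     = IsPLS.cell pls i j
isPLS⇒atMostOnce pls row  i s j j' = IsPLS.row pls i j j' s
isPLS⇒atMostOnce pls col  j s i i' = IsPLS.col pls i i' j s

atMostOnce⇒isPLS : AtMostOnce cell P → AtMostOnce row P → AtMostOnce col P → IsPLS P
atMostOnce⇒isPLS cells rows cols = record
  { cell = cells
  ; row  = λ i j j' s → rows i s j j'
  ; col  = λ i i' j s → cols j s i i'
  }

isPLS-⊆ : A ⊆ B → IsPLS B → IsPLS A
isPLS-⊆ {A = A} A⊆B pls = atMostOnce⇒isPLS (amo cell) (amo row) (amo col)
  where
  amo : ∀ d → AtMostOnce d A
  amo d a b x y p q = isPLS⇒atMostOnce pls d a b x y (A⊆B _ p) (A⊆B _ q)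

latin⇒atMostOnce : IsLatinSquare L → ∀ d → AtMostOnce d L
latin⇒atMostOnce = isPLS⇒atMostOnce ∘ IsLatinSquare.pls

latin⇒covers : IsLatinSquare L → ∀ d → Covers d L
latin⇒covers ls cell = IsLatinSquare.full ls
latin⇒covers ls row i = total∧injective⇒surjective (IsLatinSquare.full ls i)
  λ {j} {j'} {s} → latin⇒atMostOnce ls row i s j j'
latin⇒covers ls col j = total∧injective⇒surjective (λ i → IsLatinSquare.full ls i j)
  λ {i} {i'} {s} → latin⇒atMostOnce ls col j s i i'

latin-⊆⇒≐ : IsLatinSquare L → IsPLS P → L ⊆ P → P ≐ L
latin-⊆⇒≐ {L = L} {P = P} ls pls L⊆P = ⊆-antisym P⊆L L⊆P
  where
  P⊆L : P ⊆ L
  P⊆L (i , j , s) p with IsLatinSquare.full ls i j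
  ... | s' , q = subst (λ z → (i , j , z) ∈ L) (sym (IsPLS.cell pls i j s s' p (L⊆P _ q))) q

-- Trades inside a Latin square

line-∖-flip : ∀ d (A B : TSet n) → AtMostOnce d A → Covers d B →
              ∀ a b → ∃[ x ] (line d a b x ∈ (A ∖ B)) → ∃[ x ] (line d a b x ∈ (B ∖ A))
line-∖-flip d A B amoA covB a b (x , p) with covB a b
... | y , q with line d a b y ∈? A
...   | no  y∉A = y , ∈-∖⁺ B A q y∉A
...   | yes y∈A = contradiction (subst (λ z → line d a b z ∈ B) (sym x≡y) q) (∈-∖⁻ʳ A B p)
  where
  x≡y : x ≡ y
  x≡y = amoA a b x y (∈-∖⁻ˡ A B p) y∈A

∖-sameLines : IsLatinSquare A → IsLatinSquare B → ∀ d → SameLines d (A ∖ B) (B ∖ A)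
∖-sameLines {A = A} {B = B} lsA lsB d a b = mk⇔
  (line-∖-flip d A B (latin⇒atMostOnce lsA d) (latin⇒covers lsB d) a b)
  (line-∖-flip d B A (latin⇒atMostOnce lsB d) (latin⇒covers lsA d) a b)

∖-isLatinTrade : IsLatinSquare A → IsLatinSquare B → ∃[ t ] (t ∈ (A ∖ B)) → IsLatinTrade (A ∖ B)
∖-isLatinTrade {A = A} {B = B} lsA lsB nonempty = record
  { nonempty = nonempty
  ; pls      = isPLS-⊆ ∖⊆ (IsLatinSquare.pls lsA)
  ; mate     = B ∖ A
             , isPLS-⊆ ∖⊆ (IsLatinSquare.pls lsB)
             , (λ t p q → ∈-∖⁻ʳ B A q (∈-∖⁻ˡ A B p))
             , ∖-sameLines lsA lsB cell
             , ∖-sameLines lsA lsB row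
             , ∖-sameLines lsA lsB col
  }

replace : TSet n → TSet n → TSet n → TSet n
replace L T T' = (L ∖ T) ∪ T'

module _ {d : Axis} {L T T' : TSet n} (same : SameLines d T T') where

  replace-covers : Covers d L → Covers d (replace L T T')
  replace-covers covL a b with covL a b
  ... | x , p with line d a b x ∈? T
  ...   | no  x∉T = x , ∈-∪⁺ˡ (L ∖ T) T' (∈-∖⁺ L T p x∉T)
  ...   | yes x∈T = map₂ (∈-∪⁺ʳ (L ∖ T) T') (Equivalence.to (same a b) (x , x∈T))

  module _ (amoL : AtMostOnce d L) (T⊆L : T ⊆ L) where

    ∖-clash : ∀ {a b x y} → line d a b x ∈ (L ∖ T) → line d a b y ∈ T' → ⊥
    ∖-clash {a} {b} {x} p q with Equivalence.from (same a b) (_ , q)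
    ... | z , r = ∈-∖⁻ʳ L T p (subst (λ w → line d a b w ∈ T) (sym x≡z) r)
      where
      x≡z : x ≡ z
      x≡z = amoL a b x z (∈-∖⁻ˡ L T p) (T⊆L _ r)

    replace-atMostOnce : AtMostOnce d T' → AtMostOnce d (replace L T T')
    replace-atMostOnce amoT' a b x y p q with ∈-∪⁻ (L ∖ T) T' p | ∈-∪⁻ (L ∖ T) T' q
    ... | inj₁ p' | inj₁ q' = amoL a b x y (∈-∖⁻ˡ L T p') (∈-∖⁻ˡ L T q')
    ... | inj₂ p' | inj₂ q' = amoT' a b x y p' q'
    ... | inj₁ p' | inj₂ q' = ⊥-elim (∖-clash p' q')
    ... | inj₂ p' | inj₁ q' = ⊥-elim (∖-clash q' p')

replace-isLatinSquare : ∀ {T'} → IsLatinSquare L → T ⊆ L → IsPLS T' → (∀ d → SameLines d T T') →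
                        IsLatinSquare (replace L T T')
replace-isLatinSquare {L = L} {T = T} {T'} ls T⊆L pls' same = record
  { pls  = atMostOnce⇒isPLS (amo cell) (amo row) (amo col)
  ; full = replace-covers {d = cell} {L = L} (same cell) (IsLatinSquare.full ls)
  }
  where
  amo : ∀ d → AtMostOnce d (replace L T T')
  amo d = replace-atMostOnce {d = d} {T' = T'} (same d) (latin⇒atMostOnce ls d) T⊆L (isPLS⇒atMostOnce pls' d)

∖-replace : ∀ {T'} → T ⊆ L → Disjoint T T' → (L ∖ replace L T T') ≐ T
∖-replace {n} {T} {L} {T'} T⊆L T#T' = ⊆-antisym
  (λ u p → ∉∖⇒∈ L T (∈-∖⁻ˡ L R p) (∈-∖⁻ʳ L R p ∘ ∈-∪⁺ˡ (L ∖ T) T'))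
  (λ u p → ∈-∖⁺ L R (T⊆L u p) ([ (λ q → ∈-∖⁻ʳ L T q p) , T#T' u p ]′ ∘ ∈-∪⁻ (L ∖ T) T'))
  where
  R : TSet n
  R = replace L T T'

isLatinTrade⇒∖ : IsLatinSquare L → IsLatinTrade T → T ⊆ L →
                 ∃[ L' ] (IsLatinSquare L' × (L ∖ L') ≐ T)
isLatinTrade⇒∖ {T = T} ls trade T⊆L with IsLatinTrade.mate trade
... | T' , pls' , T#T' , sameCells , sameRows , sameCols =
  replace _ T T' , replace-isLatinSquare {T = T} ls T⊆L pls' same , ∖-replace {T = T} T⊆L T#T'
  where
  same : ∀ d → SameLines d T T'
  same cell = sameCells
  same row  = sameRows
  same col  = sameCols

-- Defining sets and trades

HitsTrades : ℕ → TSet n → TSet n → Set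
HitsTrades {n} k L D = ∀ (T : TSet n) → IsLatinTrade T → T ⊆ L → ∣ D ∩ T ∣ ≥ k

TightTradeThrough : ℕ → TSet n → TSet n → Triple n → Set
TightTradeThrough k L D t = ∃[ T ] (IsLatinTrade T × T ⊆ L × t ∈ T × ∣ T ∩ D ∣ ≡ k)

defining⇒meetsTrades : IsLatinSquare L → IsDefiningSet L E → IsLatinTrade T → T ⊆ L → ¬ Disjoint E T
defining⇒meetsTrades {L = L} {E = E} {T = T} ls (E⊆L , unique) trade T⊆L E#T
  with isLatinTrade⇒∖ ls trade T⊆L | IsLatinTrade.nonempty trade
... | L' , ls' , L∖L'≐T | v , v∈T =
  ∈-∖⁻ʳ L L' (≐⇒⊇ L∖L'≐T v v∈T) (≐⇒⊇ (unique L' ls' E⊆L') v (T⊆L v v∈T))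
  where
  E⊆L' : E ⊆ L'
  E⊆L' u u∈E = ∉∖⇒∈ L L' (E⊆L u u∈E) (E#T u u∈E ∘ ≐⇒⊆ L∖L'≐T u)

meetsTrades⇒defining : IsLatinSquare L → E ⊆ L →
                       (∀ T → IsLatinTrade T → T ⊆ L → ¬ Disjoint E T) → IsDefiningSet L E
meetsTrades⇒defining {L = L} {E = E} ls E⊆L meets =
  E⊆L , λ L' ls' E⊆L' → latin-⊆⇒≐ ls (IsLatinSquare.pls ls') (L⊆ ls' E⊆L')
  where
  L⊆ : ∀ {L'} → IsLatinSquare L' → E ⊆ L' → L ⊆ L'
  L⊆ {L'} ls' E⊆L' v v∈L with v ∈? L'
  ... | yes v∈L' = v∈L'
  ... | no  v∉L' = contradiction E#L∖L' (meets (L ∖ L') (∖-isLatinTrade ls ls' (v , ∈-∖⁺ L L' v∈L v∉L')) ∖⊆)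
    where
    E#L∖L' : Disjoint E (L ∖ L')
    E#L∖L' u u∈E u∈L∖L' = ∈-∖⁻ʳ L L' u∈L∖L' (E⊆L' u u∈E)

hitsTrades⇒kStrong : IsLatinSquare L → D ⊆ L → 1 ≤ k → HitsTrades k L D → IsKStrong k L D
hitsTrades⇒kStrong {L = L} {D = D} {k = k} ls D⊆L k≥1 hits = meetsTrades⇒defining ls D⊆L misses , hits
  where
  misses : ∀ T → IsLatinTrade T → T ⊆ L → ¬ Disjoint D T
  misses T trade T⊆L D#T = contradiction (≤-trans k≥1 (≤-trans (hits T trade T⊆L) (≤-reflexive ∣D∩T∣≡0))) λ ()
    where
    ∣D∩T∣≡0 : ∣ D ∩ T ∣ ≡ 0
    ∣D∩T∣≡0 = empty⇒∣∣≡0 λ u p → D#T u (∈-∩⁻ˡ D T p) (∈-∩⁻ʳ D T p)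

kStrong⇒removal-defining : IsLatinSquare L → IsKStrong k L D →
                           ∀ D' → ∣ D' ∣ < k → IsDefiningSet L (D ∖ D')
kStrong⇒removal-defining {L = L} {D = D} ls ((D⊆L , _) , hits) D' ∣D'∣<k =
  meetsTrades⇒defining ls (λ u → D⊆L u ∘ ∈-∖⁻ˡ D D') λ T trade T⊆L D∖D'#T →
    <⇒≱ ∣D'∣<k (≤-trans (hits T trade T⊆L) (⊆⇒∣∣≤ (D∩T⊆D' D∖D'#T)))
  where
  D∩T⊆D' : ∀ {T} → Disjoint (D ∖ D') T → (D ∩ T) ⊆ D'
  D∩T⊆D' {T} D∖D'#T u p = ∉∖⇒∈ D D' (∈-∩⁻ˡ D T p) λ q → D∖D'#T u q (∈-∩⁻ʳ D T p)

removal-defining⇒kStrong : IsLatinSquare L → D ⊆ L → 1 ≤ k →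
                           (∀ D' → D' ⊆ D → ∣ D' ∣ < k → IsDefiningSet L (D ∖ D')) → IsKStrong k L D
removal-defining⇒kStrong {L = L} {D = D} {k = k} ls D⊆L k≥1 removal-defining =
  hitsTrades⇒kStrong ls D⊆L k≥1 λ T trade T⊆L → ≮⇒≥ λ ∣D∩T∣<k →
    defining⇒meetsTrades ls (removal-defining (D ∩ T) (λ u → ∈-∩⁻ˡ D T) ∣D∩T∣<k) trade T⊆L
      λ u p q → ∈-∖⁻ʳ D (D ∩ T) p (∈-∩⁺ D T (∈-∖⁻ˡ D (D ∩ T) p) q)

tightTrades⇒minimallyKStrong : IsKStrong k L D → (∀ t → t ∈ D → TightTradeThrough k L D t) →
                               IsMinimallyKStrong k L D
tightTrades⇒minimallyKStrong {k = k} {L = L} {D = D} kStrong tight = kStrong , not-kStrong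
  where
  not-kStrong : ∀ D'' → D'' ⊂ D → ¬ IsKStrong k L D''
  not-kStrong D'' (D''⊆D , t , t∈D , t∉D'') (_ , hits'') with tight t t∈D
  ... | T , trade , T⊆L , t∈T , ∣T∩D∣≡k = <⇒≱ (subst (∣ D'' ∩ T ∣ <_) ∣T∩D∣≡k ∣D''∩T∣<∣T∩D∣) (hits'' T trade T⊆L)
    where
    ∣D''∩T∣<∣T∩D∣ : ∣ D'' ∩ T ∣ < ∣ T ∩ D ∣
    ∣D''∩T∣<∣T∩D∣ = ⊂⇒∣∣< (λ u p → ∈-∩⁺ T D (∈-∩⁻ʳ D'' T p) (D''⊆D u (∈-∩⁻ˡ D'' T p)))
                          (∈-∩⁺ T D t∈T t∈D) (t∉D'' ∘ ∈-∩⁻ˡ D'' T)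

-- Deciding whether a tight trade exists

atMostOnce? : ∀ d (P : TSet n) → Dec (AtMostOnce d P)
atMostOnce? d P = all? λ a → all? λ b → all? λ x → all? λ y →
  line d a b x ∈? P →-dec line d a b y ∈? P →-dec x Fin.≟ y

covers? : ∀ d (P : TSet n) → Dec (Covers d P)
covers? d P = all? λ a → all? λ b → any? λ x → line d a b x ∈? P

isLatinSquare? : (L : TSet n) → Dec (IsLatinSquare L)
isLatinSquare? L = map′
  (λ (cells , rows , cols , full) → record { pls = atMostOnce⇒isPLS cells rows cols ; full = full })
  (λ ls → latin⇒atMostOnce ls cell , latin⇒atMostOnce ls row , latin⇒atMostOnce ls col , IsLatinSquare.full ls)
  (atMostOnce? cell L ×-dec atMostOnce? row L ×-dec atMostOnce? col L ×-dec covers? cell L)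

isLatinSquare-≐ : A ≐ B → IsLatinSquare A → IsLatinSquare B
isLatinSquare-≐ A≐B ls = record
  { pls  = isPLS-⊆ (≐⇒⊇ A≐B) (IsLatinSquare.pls ls)
  ; full = λ i j → map₂ (≐⇒⊆ A≐B _) (IsLatinSquare.full ls i j)
  }

any-TSet? : {P : TSet n → Set} → (∀ {A B} → A ≐ B → P A → P B) → (∀ S → Dec (P S)) → Dec (∃ P)
any-TSet? {n} resp P? = map′
  (λ (v , p) → ofSubset v , p)
  (λ (S , p) → toSubset S , resp (λ t → sym (ofSubset∘toSubset S t)) p)
  (anySubset? (P? ∘ ofSubset))
  where
  encode : Triple n → Fin (n * (n * n))
  encode (i , j , s) = combine i (combine j s)
  decode : Fin (n * (n * n)) → Triple n
  decode = map₂ (remQuot n) ∘ remQuot (n * n)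
  decode∘encode : ∀ t → decode (encode t) ≡ t
  decode∘encode (i , j , s) =
    trans (cong (map₂ (remQuot n)) (remQuot-combine i (combine j s))) (cong (i ,_) (remQuot-combine j s))
  ofSubset : Subset (n * (n * n)) → TSet n
  ofSubset v t = lookup v (encode t)
  toSubset : TSet n → Subset (n * (n * n))
  toSubset S = tabulate (S ∘ decode)
  ofSubset∘toSubset : ∀ S t → ofSubset (toSubset S) t ≡ S t
  ofSubset∘toSubset S t = trans (lookup∘tabulate (S ∘ decode) (encode t)) (cong S (decode∘encode t))

tightTradeThrough? : IsLatinSquare L → ∀ D k (t : Triple n) → Dec (TightTradeThrough k L D t)
tightTradeThrough? {n} {L} ls D k t = map′ trade-of-square square-of-trade (any-TSet? resp witness?)
  where
  Witness : TSet n → Set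
  Witness L' = IsLatinSquare L' × t ∈ (L ∖ L') × ∣ (L ∖ L') ∩ D ∣ ≡ k
  witness? : ∀ L' → Dec (Witness L')
  witness? L' = isLatinSquare? L' ×-dec t ∈? (L ∖ L') ×-dec ∣ (L ∖ L') ∩ D ∣ ℕ.≟ k
  resp : A ≐ B → Witness A → Witness B
  resp {A} {B} A≐B (lsA , t∈ , c) = isLatinSquare-≐ A≐B lsA , ≐⇒⊆ ∖≐ t t∈ , trans (sym (≐⇒∣∣≡ ∩≐)) c
    where
    ∖≐ : (L ∖ A) ≐ (L ∖ B)
    ∖≐ u = cong (λ b → L u ∧ not b) (A≐B u)
    ∩≐ : ((L ∖ A) ∩ D) ≐ ((L ∖ B) ∩ D)
    ∩≐ u = cong (_∧ D u) (∖≐ u)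
  trade-of-square : ∃ Witness → TightTradeThrough k L D t
  trade-of-square (L' , ls' , t∈ , c) = L ∖ L' , ∖-isLatinTrade ls ls' (t , t∈) , ∖⊆ , t∈ , c
  square-of-trade : TightTradeThrough k L D t → ∃ Witness
  square-of-trade (T , trade , T⊆L , t∈T , c) with isLatinTrade⇒∖ ls trade T⊆L
  ... | L' , ls' , L∖L'≐T = L' , ls' , ≐⇒⊇ L∖L'≐T t t∈T , trans (≐⇒∣∣≡ λ u → cong (_∧ D u) (L∖L'≐T u)) c

minimallyKStrong⇒tightTrades : IsLatinSquare L → D ⊆ L → 1 ≤ k → IsMinimallyKStrong k L D →
                               ∀ t → t ∈ D → TightTradeThrough k L D t
minimallyKStrong⇒tightTrades {n} {L} {D} {k} ls D⊆L k≥1 ((_ , hits) , minimal) t t∈D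
  with tightTradeThrough? ls D k t
... | yes tight = tight
... | no ¬tight = contradiction (hitsTrades⇒kStrong ls (λ u → D⊆L u ∘ ∈-∖⁻ˡ D ｛ t ｝) k≥1 hits⁻)
                                (minimal (D ∖ ｛ t ｝) (∖⊆ , t , t∈D , λ p → ∈-∖⁻ʳ D ｛ t ｝ p (∈｛｝ {t = t})))
  where
  D⁻ : TSet n
  D⁻ = D ∖ ｛ t ｝
  ∈D⁻∩ : ∀ {T u} → u ∈ (D ∩ T) → u ≢ t → u ∈ (D⁻ ∩ T)
  ∈D⁻∩ {T} p u≢t = ∈-∩⁺ D⁻ T (∈-∖⁺ D ｛ t ｝ (∈-∩⁻ˡ D T p) (≢⇒∉｛｝ u≢t)) (∈-∩⁻ʳ D T p)
  hits⁻ : HitsTrades k L D⁻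
  hits⁻ T trade T⊆L with t ∈? T
  ... | no t∉T = ≤-trans (hits T trade T⊆L)
    (⊆⇒∣∣≤ {A = D ∩ T} {B = D⁻ ∩ T} λ u p → ∈D⁻∩ {T = T} p λ { refl → t∉T (∈-∩⁻ʳ D T p) })
  ... | yes t∈T = s≤s⁻¹ (≤-trans k<∣D∩T∣
    (⊆-except⇒∣∣≤suc {A = D ∩ T} {B = D⁻ ∩ T} t λ u → ∈D⁻∩ {T = T}))
    where
    k<∣D∩T∣ : k < ∣ D ∩ T ∣
    k<∣D∩T∣ = ≤∧≢⇒< (hits T trade T⊆L) λ k≡ → ¬tight (T , trade , T⊆L , t∈T , trans (∣∩∣-comm T D) (sym k≡))

lemma1 : (n : ℕ) (L : TSet n) → IsLatinSquare L → (D : TSet n) → D ⊆ L →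
         (k : ℕ) → 1 ≤ k →
         (IsKStrong k L D ⇔ (∀ (D' : TSet n) → D' ⊆ D → ∣ D' ∣ < k → IsDefiningSet L (D ∖ D')))
         × (IsKStrong k L D →
            (IsMinimallyKStrong k L D ⇔
               (∀ t → t ∈ D → ∃[ T ] (IsLatinTrade T × T ⊆ L × t ∈ T × ∣ T ∩ D ∣ ≡ k))))
lemma1 n L ls D D⊆L k k≥1 =
  mk⇔ (λ kStrong D' _ → kStrong⇒removal-defining ls kStrong D') (removal-defining⇒kStrong ls D⊆L k≥1) ,
  λ kStrong → mk⇔ (minimallyKStrong⇒tightTrades ls D⊆L k≥1) (tightTrades⇒minimallyKStrong kStrong)
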